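{- Let $G$ be a small crowned graph with head $H$, crown $C$ and a perfect matching $M$ consisting of edges between $H$ and $C$, and let $v\in H$. (1) If $\mathrm{prop}_{\mathrm{avoid}}(G,v)$ fails, then there is no $S\in\mathrm{Sol}(G)$ with $v\notin S$. (2) Otherwise, $\mathrm{prop}_{\mathrm{avoid}}(G,v)$ returns $(F,\bar F)$ with $\bar F=M_V(F)$; letting $H'=H\setminus(F\cup\bar F)$, $C'=C\setminus(F\cup\bar F)$ and $G'=G[H'\cup C']$, every $S\in\mathrm{Sol}(G)$ with $v\notin S$ satisfies $F\subseteq S$ and $S\cap\bar F=\emptyset$, and moreover $G'$ is a crowned graph (head $H'$, crown $C'$) with $|C'|=|H'|$ and $S\cap(C'\cup H')\in\mathrm{Sol}(G')$. (3) In the situation of (2), for every $S'\in\mathrm{Sol}(G')$, the set $F\cup S'$ belongs to $\mathrm{Sol}(G)$ and does not contain $v$.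
   Context: A crowned graph is a graph whose vertex set is partitioned into $H\cup C$ (head $H$, crown $C$) such that $C$ is an independent set and there is a matching consisting of edges between $H$ and $C$ of size $|H|$; it is small if $|H|=|C|$. For a small crowned graph $G$ with head $H$, $\mathrm{Sol}(G)$ is the set of vertex covers of $G$ of size exactly $|H|$. For $S\subseteq V(G)$, $N(S)=\bigcup_{u\in S}N(u)\setminus S$. For a set $T$ of vertices containing at most one endpoint of each edge of $M$, $M_V(T)=\{w' : ww'\in M, w\in T\}$. $\mathrm{prop}_{\mathrm{avoid}}(G,v)$: set $\bar F_0=\{v\}$ and $F_0=\emptyset$. For $i=1,2,\dots$: if some edge of $M$ has both endpoints in $N(\bar F_{i-1})$, fail; otherwise set $F_i=N(\bar F_{i-1})$. Then, if $M_V(F_i)$ is not an independent set of $G$, fail; otherwise set $\bar F_i=M_V(F_i)$. Stop (without failure) at the first $i$ with $F_i=F_{i-1}$ and $\bar F_i=\bar F_{i-1}$, and return $(F,\bar F)=(F_i,\bar F_i)$. -}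

module Defs where

open import Data.Bool using (Bool; true; false; not; _∧_; _∨_; if_then_else_)
open import Data.Nat using (ℕ; zero; suc; _<_)
open import Data.Fin using (Fin; zero; suc)
open import Data.Fin.Properties using (_≟_)
open import Data.Fin.Subset using (Subset; _∈_; _∉_; _⊆_; _∪_; _∩_; _─_; ∣_∣; ⁅_⁆; ⊥; ⊤)
open import Data.Vec using (lookup; tabulate)
open import Data.List using (List; length; map)
open import Data.Bool.ListAction using (any)
open import Data.List.Relation.Unary.All using (All)
open import Data.List.Relation.Unary.Unique.Propositional using (Unique)
open import Data.Product using (_×_; _,_; Σ; Σ-syntax; proj₁; proj₂)
open import Data.Sum using (_⊎_)
open import Data.Maybe using (Maybe; just; nothing; _>>=_)
open import Relation.Nullary using (¬_)
open import Relation.Nullary.Decidable using (⌊_⌋)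
open import Relation.Binary.PropositionalEquality using (_≡_; _≢_)

record Graph (n : ℕ) : Set where
  field
    adj    : Fin n → Fin n → Bool
    sym    : ∀ a b → adj a b ≡ adj b a
    irrefl : ∀ a → adj a a ≡ false
open Graph public

anyFin : ∀ {n} → (Fin n → Bool) → Bool
anyFin {zero}  f = false
anyFin {suc n} f = f zero ∨ anyFin (λ i → f (suc i))

-- Notions relative to an induced subgraph G[V] (V a vertex subset).

Independent : ∀ {n} → Graph n → Subset n → Set
Independent G S = ∀ a b → a ∈ S → b ∈ S → adj G a b ≡ false

IsMatchingBetween : ∀ {n} → Graph n → Subset n → Subset n → List (Fin n × Fin n) → Set
IsMatchingBetween G H C M =
  All (λ e → (proj₁ e ∈ H) × (proj₂ e ∈ C) × (adj G (proj₁ e) (proj₂ e) ≡ true)) M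
  × Unique (map proj₁ M) × Unique (map proj₂ M)

IsCrownedWith : ∀ {n} → Graph n → (V H C : Subset n) → List (Fin n × Fin n) → Set
IsCrownedWith G V H C M =
  (H ∪ C ≡ V) × (H ∩ C ≡ ⊥) × Independent G C
  × IsMatchingBetween G H C M × (length M ≡ ∣ H ∣)

IsCrowned : ∀ {n} → Graph n → (V H C : Subset n) → Set
IsCrowned G V H C = Σ[ M ∈ List (Fin _ × Fin _) ] IsCrownedWith G V H C M

-- S ∈ Sol(G[V]) for the (small crowned) graph G[V] with head H:
-- S is a vertex cover of G[V] of size exactly |H|.
IsVertexCover : ∀ {n} → Graph n → (V S : Subset n) → Set
IsVertexCover G V S =
  S ⊆ V × (∀ a b → a ∈ V → b ∈ V → adj G a b ≡ true → a ∈ S ⊎ b ∈ S)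

Sol : ∀ {n} → Graph n → (V H S : Subset n) → Set
Sol G V H S = IsVertexCover G V S × (∣ S ∣ ≡ ∣ H ∣)

nbhd : ∀ {n} → Graph n → Subset n → Subset n
nbhd G S = tabulate (λ u → not (lookup S u) ∧ anyFin (λ w → lookup S w ∧ adj G w u))

MV : ∀ {n} → List (Fin n × Fin n) → Subset n → Subset n
MV M T = tabulate (λ x → any (λ e →
  (lookup T (proj₁ e) ∧ ⌊ proj₂ e ≟ x ⌋) ∨ (lookup T (proj₂ e) ∧ ⌊ proj₁ e ≟ x ⌋)) M)

edgeInside : ∀ {n} → List (Fin n × Fin n) → Subset n → Bool
edgeInside M X = any (λ e → lookup X (proj₁ e) ∧ lookup X (proj₂ e)) M

indepB : ∀ {n} → Graph n → Subset n → Bool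
indepB G S = not (anyFin (λ a → anyFin (λ b → lookup S a ∧ lookup S b ∧ adj G a b)))

avoidStep : ∀ {n} → Graph n → List (Fin n × Fin n) → Subset n × Subset n
          → Maybe (Subset n × Subset n)
avoidStep G M (F , F̄) =
  if edgeInside M (nbhd G F̄) then nothing
  else (if indepB G (MV M (nbhd G F̄))
        then just (nbhd G F̄ , MV M (nbhd G F̄))
        else nothing)

-- the (unstopped) sequence of states: i ↦ (F_i , F̄_i), nothing = failure
avoidIter : ∀ {n} → Graph n → List (Fin n × Fin n) → Fin n → ℕ
          → Maybe (Subset n × Subset n)
avoidIter G M v zero    = just (⊥ , ⁅ v ⁆)
avoidIter G M v (suc i) = avoidIter G M v i >>= avoidStep G M

NotStoppedBefore : ∀ {n} → Graph n → List (Fin n × Fin n) → Fin n → ℕ → Set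
NotStoppedBefore G M v i =
  ∀ j → j < i → avoidIter G M v (suc j) ≢ avoidIter G M v j

PropAvoidFails : ∀ {n} → Graph n → List (Fin n × Fin n) → Fin n → Set
PropAvoidFails G M v =
  Σ[ i ∈ ℕ ] (avoidIter G M v (suc i) ≡ nothing) × NotStoppedBefore G M v i

-- prop_avoid(G,v) returns (F , F̄): round i+1 is the first round whose
-- state equals the previous one, and that state is (F , F̄)
PropAvoidReturns : ∀ {n} → Graph n → List (Fin n × Fin n) → Fin n
                 → Subset n → Subset n → Set
PropAvoidReturns G M v F F̄ =
  Σ[ i ∈ ℕ ] (avoidIter G M v (suc i) ≡ just (F , F̄))
           × (avoidIter G M v i ≡ just (F , F̄))
           × NotStoppedBefore G M v i

{-# OPTIONS --safe #-}
module Submission where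

-- A vertex cover S of size |H| = |M| contains exactly one endpoint of every
-- edge of the perfect matching M: |S| is the sum, over the edges of M, of the
-- number of their endpoints in S.  Hence, if v ∉ S, every state (F, F̄) of
-- prop_avoid satisfies F ⊆ S and F̄ ∩ S = ∅ (N(F̄) ⊆ S because S covers the
-- edges leaving F̄, and the mates of N(F̄) avoid S), so the procedure cannot
-- fail.  Independently of S, F̄ stays an independent set containing v and
-- grows, since each x ∈ F̄ has its mate in N(F̄); so it stabilises within n
-- rounds.  At the fixed point F = N(F̄), F̄ = M_V(F), every edge of M either
-- joins F to F̄ or avoids F ∪ F̄.  The latter edges crown G', counting edges
-- gives |F| + |H'| = |H|, and S ↦ S ∖ (F ∪ F̄), S' ↦ F ∪ S' translate between
-- the solutions of G and G'.

open import Defs hiding (sym)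
open import Data.Bool using (Bool; true; false; not; _∧_; _∨_; if_then_else_; T)
open import Data.Bool.Properties using (T-∧; T-∨; T-≡; ¬-not)
open import Data.Empty using () renaming (⊥-elim to absurd)
open import Data.Fin using (Fin; zero; suc)
open import Data.Fin.Properties using (_≟_)
open import Data.Fin.Subset using (Subset; inside; outside; _∈_; _∉_; _⊆_; _⊂_; _∪_; _∩_; _─_; _-_; ∣_∣; ⁅_⁆; ⊥; ⊤)
open import Data.Fin.Subset.Properties
  using (_∈?_; ∈⊤; ∉⊥; ⊥⊆; x∈⁅x⁆; x∈⁅y⁆⇒x≡y; x∈p∪q⁺; x∈p∪q⁻; x∈p∩q⁺; x∈p∩q⁻; x∈p∧x∉q⇒x∈p─q; p─q⊆p; p─⊥≡p;
         x∈p∧x≢y⇒x∈p-y; x∈p⇒∣p-x∣<∣p∣; ∪-comm; p⊂q⇒∣p∣<∣q∣; _⊂?_; ⊆-antisym; ∣p∣≤n; ∣⊥∣≡0; Empty-unique)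
open import Data.List using (List; []; _∷_; length; map; _++_; filter)
open import Data.List.Properties using (map-++; map-∘; map-cong-local; length-map)
open import Data.List.Membership.Propositional using (find; lose) renaming (_∈_ to _∈ₗ_)
open import Data.List.Membership.Propositional.Properties using (∈-map⁺; ∈-map⁻; ∈-++⁺ˡ; ∈-++⁺ʳ; ∈-filter⁻)
open import Data.List.Relation.Unary.All as All using (All; []; _∷_)
open import Data.List.Relation.Unary.All.Properties using (¬Any⇒All¬)
import Data.List.Relation.Unary.All.Properties as All
open import Data.List.Relation.Unary.Any as Any using (Any; any?)
open import Data.List.Relation.Unary.Any.Properties using (any⁺; any⁻)
open import Data.List.Relation.Unary.AllPairs using ([]; _∷_)
import Data.List.Relation.Unary.AllPairs.Properties as AllPairs
open import Data.List.Relation.Unary.Unique.Propositional using (Unique)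
open import Data.List.Relation.Unary.Unique.Propositional.Properties using (++⁺)
open import Data.Maybe using (just; nothing; _>>=_)
open import Data.Maybe.Properties using (just-injective)
import Data.Maybe.Properties as Maybe
open import Data.Nat using (ℕ; zero; suc; _+_; _≤_; _<_; z≤n; s≤s)
open import Data.Nat.ListAction using (sum)
open import Data.Nat.ListAction.Properties using (sum-++)
open import Data.Nat.Properties
  using (+-suc; +-identityʳ; +-commutativeSemigroup; +-mono-≤; +-cancelˡ-≡;
         ≤-refl; ≤-trans; ≤-reflexive; <-irrefl; ≤-<-trans; <⇒≱; m≤m+n; m≤n+m; ≤⇒≯; m<1+n⇒m<n∨m≡n)
open import Algebra.Properties.CommutativeSemigroup +-commutativeSemigroup using (interchange)
open import Data.Product using (_×_; _,_; proj₁; proj₂; ∃-syntax; ∃₂; Σ-syntax)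
import Data.Product as Product
import Data.Product.Properties as Product
open import Data.Sum using (_⊎_; inj₁; inj₂; [_,_]′; swap)
import Data.Sum as Sum
import Data.Vec.Properties as Vec
import Data.Bool.Properties as Bool
open import Data.Vec using ([]; _∷_; here; there; lookup)
open import Data.Vec.Properties using (lookup∘tabulate)
open import Function using (_∘_; _$_; id; flip)
open import Function.Bundles using (Equivalence)
open import Relation.Nullary using (¬_; yes; no; does; contradiction)
open import Relation.Nullary.Decidable using (toWitness; fromWitness; decidable-stable; ⌊_⌋)
open import Relation.Unary using (Decidable)
open import Relation.Binary.PropositionalEquality using (_≡_; _≢_; refl; sym; trans; cong; cong₂; subst; module ≡-Reasoning)

open Equivalence using (to; from)

private
  variable
    A : Set
    n : ℕ
    x y : Fin n
    p q : Subset n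
    xs : List A

-- Sums over lists and cardinalities of subsets

sum-map-+ : (f g : A → ℕ) (xs : List A) → sum (map (λ x → f x + g x) xs) ≡ sum (map f xs) + sum (map g xs)
sum-map-+ f g [] = refl
sum-map-+ f g (x ∷ xs) = begin
  f x + g x + sum (map (λ x → f x + g x) xs)     ≡⟨ cong (f x + g x +_) (sum-map-+ f g xs) ⟩
  f x + g x + (sum (map f xs) + sum (map g xs))   ≡⟨ interchange (f x) (g x) _ _ ⟩
  f x + sum (map f xs) + (g x + sum (map g xs))   ∎
  where open ≡-Reasoning

sum-map-1 : {f : A → ℕ} → All (λ x → f x ≡ 1) xs → sum (map f xs) ≡ length xs
sum-map-1 []         = refl
sum-map-1 (fx≡1 ∷ ps) = cong₂ _+_ fx≡1 (sum-map-1 ps)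

length≤sum-map : {f : A → ℕ} → All (λ x → 1 ≤ f x) xs → length xs ≤ sum (map f xs)
length≤sum-map []          = z≤n
length≤sum-map (1≤fx ∷ ps) = +-mono-≤ 1≤fx (length≤sum-map ps)

length<sum-map : {f : A → ℕ} → All (λ x → 1 ≤ f x) xs → Any (λ x → 2 ≤ f x) xs → length xs < sum (map f xs)
length<sum-map (_ ∷ ps)    (Any.here 2≤fx) = +-mono-≤ 2≤fx (length≤sum-map ps)
length<sum-map (1≤fx ∷ ps) (Any.there any) = +-mono-≤ 1≤fx (length<sum-map ps any)

length-filter : {P : A → Set} (P? : Decidable P) (xs : List A) →
                length (filter P? xs) ≡ sum (map (λ x → if does (P? x) then 1 else 0) xs)
length-filter P? [] = refl
length-filter P? (x ∷ xs) with does (P? x)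
... | true  = cong suc (length-filter P? xs)
... | false = length-filter P? xs

least : {P : ℕ → Set} → Decidable P → ∀ {n} → P n → ∃[ i ] P i × (∀ j → j < i → ¬ P j)
least {P} P? {n} Pn with search (suc n)
  where
  search : ∀ N → (∃[ i ] P i × (∀ j → j < i → ¬ P j)) ⊎ (∀ j → j < N → ¬ P j)
  search zero = inj₂ (λ _ ())
  search (suc N) with search N
  ... | inj₁ found = inj₁ found
  ... | inj₂ none with P? N
  ...   | yes PN = inj₁ (N , PN , none)
  ...   | no ¬PN = inj₂ λ j j<1+N → [ none j , (λ { refl → ¬PN }) ]′ (m<1+n⇒m<n∨m≡n j<1+N)
... | inj₁ found = found
... | inj₂ none  = contradiction Pn (none n ≤-refl)

-- Defined through `does`, so that `length-filter` counts with it on the nose.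
𝟙 : Subset n → Fin n → ℕ
𝟙 p x = if does (x ∈? p) then 1 else 0

𝟙-∈ : x ∈ p → 𝟙 p x ≡ 1
𝟙-∈ {x = x} {p} x∈p with x ∈? p
... | yes _   = refl
... | no x∉p  = contradiction x∈p x∉p

𝟙-∉ : x ∉ p → 𝟙 p x ≡ 0
𝟙-∉ {x = x} {p} x∉p with x ∈? p
... | yes x∈p = contradiction x∈p x∉p
... | no _    = refl

𝟙-cong : (x ∈ p → x ∈ q) → (x ∈ q → x ∈ p) → 𝟙 p x ≡ 𝟙 q x
𝟙-cong {x = x} {p} {q} p⇒q q⇒p with x ∈? p | x ∈? q
... | yes _   | yes _   = refl
... | no _    | no _    = refl
... | yes x∈p | no x∉q  = contradiction (p⇒q x∈p) x∉q
... | no x∉p  | yes x∈q = contradiction (q⇒p x∈q) x∉p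

∣p∣≡𝟙+∣p-x∣ : ∀ (p : Subset n) x → ∣ p ∣ ≡ 𝟙 p x + ∣ p - x ∣
∣p∣≡𝟙+∣p-x∣ (inside  ∷ p) zero    = cong (suc ∘ ∣_∣) (sym (p─⊥≡p p))
∣p∣≡𝟙+∣p-x∣ (outside ∷ p) zero    = cong ∣_∣ (sym (p─⊥≡p p))
∣p∣≡𝟙+∣p-x∣ (inside  ∷ p) (suc x) = trans (cong suc (∣p∣≡𝟙+∣p-x∣ p x)) (sym (+-suc _ _))
∣p∣≡𝟙+∣p-x∣ (outside ∷ p) (suc x) = ∣p∣≡𝟙+∣p-x∣ p x

x∈p─q⇒x∉q : x ∈ p ─ q → x ∉ q
x∈p─q⇒x∉q {p = _ ∷ _} {outside ∷ _} here      ()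
x∈p─q⇒x∉q {p = _ ∷ _} {_ ∷ _}       (there x∈) (there x∈q) = x∈p─q⇒x∉q x∈ x∈q

x∈q⇒x∉p─q : x ∈ q → x ∉ p ─ q
x∈q⇒x∉p─q x∈q x∈p─q = x∈p─q⇒x∉q x∈p─q x∈q

x∉p⇒x∉p─q : x ∉ p → x ∉ p ─ q
x∉p⇒x∉p─q {p = p} {q} x∉p = x∉p ∘ p─q⊆p p q

x∉p∧x∉q⇒x∉p∪q : x ∉ p → x ∉ q → x ∉ p ∪ q
x∉p∧x∉q⇒x∉p∪q {p = p} {q} x∉p x∉q = [ x∉p , x∉q ]′ ∘ x∈p∪q⁻ p q

∣p∪q∣≡∣p∣+∣q∣ : ∀ (p q : Subset n) → (∀ {x} → x ∈ p → x ∉ q) → ∣ p ∪ q ∣ ≡ ∣ p ∣ + ∣ q ∣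
∣p∪q∣≡∣p∣+∣q∣ []            []            _        = refl
∣p∪q∣≡∣p∣+∣q∣ (inside  ∷ p) (inside  ∷ q) disjoint = contradiction here (disjoint here)
∣p∪q∣≡∣p∣+∣q∣ (inside  ∷ p) (outside ∷ q) disjoint =
  cong suc (∣p∪q∣≡∣p∣+∣q∣ p q λ x∈p x∈q → disjoint (there x∈p) (there x∈q))
∣p∪q∣≡∣p∣+∣q∣ (outside ∷ p) (inside  ∷ q) disjoint =
  trans (cong suc (∣p∪q∣≡∣p∣+∣q∣ p q λ x∈p x∈q → disjoint (there x∈p) (there x∈q))) (sym (+-suc _ _))
∣p∪q∣≡∣p∣+∣q∣ (outside ∷ p) (outside ∷ q) disjoint =
  ∣p∪q∣≡∣p∣+∣q∣ p q λ x∈p x∈q → disjoint (there x∈p) (there x∈q)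

⊆∧⊄⇒≡ : p ⊆ q → ¬ p ⊂ q → p ≡ q
⊆∧⊄⇒≡ {p = p} p⊆q p⊄q =
  ⊆-antisym p⊆q λ {x} x∈q → decidable-stable (x ∈? p) λ x∉p → p⊄q (p⊆q , x , x∈q , x∉p)

All∈p-x : {xs : List (Fin n)} → All (x ≢_) xs → All (_∈ p) xs → All (_∈ p - x) xs
All∈p-x x∉xs xs⊆p = All.zipWith (λ (x≢y , y∈p) → x∈p∧x≢y⇒x∈p-y y∈p (x≢y ∘ sym)) (x∉xs , xs⊆p)

Unique⇒length≤∣p∣ : {xs : List (Fin n)} → Unique xs → All (_∈ p) xs → length xs ≤ ∣ p ∣
Unique⇒length≤∣p∣ []              []           = z≤n
Unique⇒length≤∣p∣ (x∉xs ∷ unique) (x∈p ∷ xs⊆p) =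
  ≤-trans (s≤s (Unique⇒length≤∣p∣ unique (All∈p-x x∉xs xs⊆p))) (x∈p⇒∣p-x∣<∣p∣ x∈p)

Unique∧length≡∣p∣⇒∈ : {xs : List (Fin n)} → Unique xs → All (_∈ p) xs → length xs ≡ ∣ p ∣ → x ∈ p → x ∈ₗ xs
Unique∧length≡∣p∣⇒∈ {p = p} {x} {xs} unique xs⊆p ∣xs∣≡∣p∣ x∈p with any? (x ≟_) xs
... | yes x∈xs = x∈xs
... | no  x∉xs = contradiction (x∈p⇒∣p-x∣<∣p∣ x∈p) (≤⇒≯ (subst (_≤ ∣ p - x ∣) ∣xs∣≡∣p∣ ∣xs∣≤∣p-x∣))
  where
  ∣xs∣≤∣p-x∣ : length xs ≤ ∣ p - x ∣
  ∣xs∣≤∣p-x∣ = Unique⇒length≤∣p∣ unique (All∈p-x (¬Any⇒All¬ xs x∉xs) xs⊆p)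

Unique⇒∣p∣≡sum𝟙 : {xs : List (Fin n)} → Unique xs → (∀ {x} → x ∈ p → x ∈ₗ xs) → ∣ p ∣ ≡ sum (map (𝟙 p) xs)
Unique⇒∣p∣≡sum𝟙 {n} {p} {[]} [] p⊆[] =
  trans (cong ∣_∣ (Empty-unique λ (_ , x∈p) → contradiction (p⊆[] x∈p) λ ())) (∣⊥∣≡0 n)
Unique⇒∣p∣≡sum𝟙 {p = p} {y ∷ ys} (y∉ys ∷ unique) p⊆y∷ys = begin
  ∣ p ∣                            ≡⟨ ∣p∣≡𝟙+∣p-x∣ p y ⟩
  𝟙 p y + ∣ p - y ∣                ≡⟨ cong (𝟙 p y +_) (Unique⇒∣p∣≡sum𝟙 unique p-y⊆ys) ⟩
  𝟙 p y + sum (map (𝟙 (p - y)) ys) ≡⟨ cong (λ zs → 𝟙 p y + sum zs) (map-cong-local (All.map 𝟙-p-y y∉ys)) ⟩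
  𝟙 p y + sum (map (𝟙 p) ys)       ∎
  where
  open ≡-Reasoning
  p-y⊆ys : ∀ {x} → x ∈ p - y → x ∈ₗ ys
  p-y⊆ys x∈p-y with p⊆y∷ys (p─q⊆p p ⁅ y ⁆ x∈p-y)
  ... | Any.here refl  = contradiction (x∈⁅x⁆ y) (x∈p─q⇒x∉q x∈p-y)
  ... | Any.there x∈ys = x∈ys
  𝟙-p-y : ∀ {z} → y ≢ z → 𝟙 (p - y) z ≡ 𝟙 p z
  𝟙-p-y y≢z = 𝟙-cong (p─q⊆p p ⁅ y ⁆) (λ z∈p → x∈p∧x≢y⇒x∈p-y z∈p (y≢z ∘ sym))

meets : Subset n → Fin n × Fin n → ℕ
meets p e = 𝟙 p (proj₁ e) + 𝟙 p (proj₂ e)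

1≤meets : ∀ {e : Fin n × Fin n} → proj₁ e ∈ p ⊎ proj₂ e ∈ p → 1 ≤ meets p e
1≤meets (inj₁ x∈p) = ≤-trans (≤-reflexive (sym (𝟙-∈ x∈p))) (m≤m+n _ _)
1≤meets (inj₂ y∈p) = ≤-trans (≤-reflexive (sym (𝟙-∈ y∈p))) (m≤n+m _ _)

2≤meets : x ∈ p → y ∈ p → 2 ≤ meets p (x , y)
2≤meets x∈p y∈p = ≤-reflexive (sym (cong₂ _+_ (𝟙-∈ x∈p) (𝟙-∈ y∈p)))

-- The Boolean procedures of Defs in terms of membership

¬T⇒T-not : ∀ {b} → ¬ T b → T (not b)
¬T⇒T-not {false} _  = _
¬T⇒T-not {true}  ¬t = ¬t _

T-not⇒¬T : ∀ {b} → T (not b) → ¬ T b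
T-not⇒¬T {false} _ ()

∈⇒T : x ∈ p → T (lookup p x)
∈⇒T here        = _
∈⇒T (there x∈p) = ∈⇒T x∈p

T⇒∈ : T (lookup p x) → x ∈ p
T⇒∈ {p = inside ∷ _} {zero}  _ = here
T⇒∈ {p = _ ∷ _}      {suc _} t = there (T⇒∈ t)

∉⇒T-not : x ∉ p → T (not (lookup p x))
∉⇒T-not x∉p = ¬T⇒T-not (x∉p ∘ T⇒∈)

T-not⇒∉ : T (not (lookup p x)) → x ∉ p
T-not⇒∉ t = T-not⇒¬T t ∘ ∈⇒T

anyFin⁺ : (f : Fin n → Bool) → T (f x) → T (anyFin f)
anyFin⁺ {x = zero}  f t = from T-∨ (inj₁ t)
anyFin⁺ {x = suc x} f t = from (T-∨ {f zero}) (inj₂ (anyFin⁺ (f ∘ suc) t))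

anyFin⁻ : (f : Fin n → Bool) → T (anyFin f) → ∃[ x ] T (f x)
anyFin⁻ {suc n} f t with to (T-∨ {f zero}) t
... | inj₁ t₀ = zero , t₀
... | inj₂ t₁ = let x , t = anyFin⁻ (f ∘ suc) t₁ in suc x , t

module _ (G : Graph n) (X : Subset n) where

  ∈-nbhd⁺ : ∀ {w u} → w ∈ X → adj G w u ≡ true → u ∉ X → u ∈ nbhd G X
  ∈-nbhd⁺ {w} {u} w∈X wu u∉X = T⇒∈ (subst T (sym (lookup∘tabulate _ u))
    (from T-∧ (∉⇒T-not u∉X , anyFin⁺ {x = w} _ (from T-∧ (∈⇒T w∈X , from T-≡ wu)))))

  ∈-nbhd⁻ : ∀ {u} → u ∈ nbhd G X → u ∉ X × ∃[ w ] w ∈ X × adj G w u ≡ true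
  ∈-nbhd⁻ {u} u∈N =
    let u∉X , t  = to T-∧ (subst T (lookup∘tabulate _ u) (∈⇒T u∈N))
        w   , t′ = anyFin⁻ _ t
        w∈X , wu = to T-∧ t′
    in T-not⇒∉ u∉X , w , T⇒∈ w∈X , to T-≡ wu

  indepB⇒Independent : T (indepB G X) → Independent G X
  indepB⇒Independent t a b a∈X b∈X = ¬-not λ ab →
    T-not⇒¬T t (anyFin⁺ {x = a} _ (anyFin⁺ {x = b} _ (from T-∧ (∈⇒T a∈X , from T-∧ (∈⇒T b∈X , from T-≡ ab)))))

  Independent⇒indepB : Independent G X → T (indepB G X)
  Independent⇒indepB independent = ¬T⇒T-not λ t →
    let a   , t₁ = anyFin⁻ _ t
        b   , t₂ = anyFin⁻ _ t₁
        a∈X , t₃ = to T-∧ t₂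
        b∈X , ab = to T-∧ t₃
    in subst T (independent a b (T⇒∈ a∈X) (T⇒∈ b∈X)) ab

Mates : List (Fin n × Fin n) → Fin n → Fin n → Set
Mates M x y = (x , y) ∈ₗ M ⊎ (y , x) ∈ₗ M

module _ (M : List (Fin n × Fin n)) (X : Subset n) where

  ∈-MV⁺ : y ∈ X → Mates M y x → x ∈ MV M X
  ∈-MV⁺ {y} {x} y∈X mates = T⇒∈ (subst T (sym (lookup∘tabulate _ x)) (any⁺ _ (witness mates)))
    where
    witness : Mates M y x → Any _ M
    witness (inj₁ yx∈M) = lose yx∈M (from T-∨ (inj₁ (from T-∧ (∈⇒T y∈X , fromWitness refl))))
    witness (inj₂ xy∈M) = lose xy∈M (from T-∨ (inj₂ (from T-∧ (∈⇒T y∈X , fromWitness refl))))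

  ∈-MV⁻ : x ∈ MV M X → ∃[ y ] y ∈ X × Mates M y x
  ∈-MV⁻ {x} x∈MV =
    let (a , b) , ab∈M , t = find (any⁻ _ M (subst T (lookup∘tabulate _ x) (∈⇒T x∈MV)))
    in decode ab∈M t
    where
    decode : ∀ {a b} → (a , b) ∈ₗ M → T ((lookup X a ∧ ⌊ b ≟ x ⌋) ∨ (lookup X b ∧ ⌊ a ≟ x ⌋)) →
             ∃[ y ] y ∈ X × Mates M y x
    decode {a} {b} ab∈M t with to (T-∨ {lookup X a ∧ ⌊ b ≟ x ⌋}) t
    ... | inj₁ t₁ = let a∈X , b≡x = to T-∧ t₁ in a , T⇒∈ a∈X , inj₁ (subst (λ z → (a , z) ∈ₗ M) (toWitness b≡x) ab∈M)
    ... | inj₂ t₂ = let b∈X , a≡x = to T-∧ t₂ in b , T⇒∈ b∈X , inj₂ (subst (λ z → (z , b) ∈ₗ M) (toWitness a≡x) ab∈M)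

  edgeInside⁻ : T (edgeInside M X) → ∃[ e ] e ∈ₗ M × proj₁ e ∈ X × proj₂ e ∈ X
  edgeInside⁻ t =
    let e , e∈M , t′ = find (any⁻ _ M t)
        a∈X , b∈X    = to T-∧ t′
    in e , e∈M , T⇒∈ a∈X , T⇒∈ b∈X

module _ (G : Graph n) (M : List (Fin n × Fin n)) {F : Subset n} (F̄ : Subset n) where

  avoidStep-just⁻ : ∀ {next} → avoidStep G M (F , F̄) ≡ just next →
                    next ≡ (nbhd G F̄ , MV M (nbhd G F̄)) × Independent G (MV M (nbhd G F̄))
  avoidStep-just⁻ eq with edgeInside M (nbhd G F̄) | indepB G (MV M (nbhd G F̄)) in independent
  avoidStep-just⁻ ()   | true  | _
  avoidStep-just⁻ ()   | false | false
  avoidStep-just⁻ refl | false | true = refl , indepB⇒Independent G (MV M (nbhd G F̄)) (subst T (sym independent) _)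

  avoidStep-just⁺ : ¬ T (edgeInside M (nbhd G F̄)) → Independent G (MV M (nbhd G F̄)) →
                    avoidStep G M (F , F̄) ≡ just (nbhd G F̄ , MV M (nbhd G F̄))
  -- The third scrutinee has the empty type T false when indepB fails.
  avoidStep-just⁺ no-edge independent
    with edgeInside M (nbhd G F̄) | indepB G (MV M (nbhd G F̄)) | Independent⇒indepB G (MV M (nbhd G F̄)) independent
  ... | false | true  | _ = refl
  ... | true  | _     | _ = contradiction _ no-edge

avoidIter-suc : ∀ {G : Graph n} {M v} i {state} → avoidIter G M v i ≡ just state →
                avoidIter G M v (suc i) ≡ avoidStep G M state
avoidIter-suc {G = G} {M} _ = cong (_>>= avoidStep G M)

⁅x⁆-independent : (G : Graph n) → Independent G ⁅ x ⁆
⁅x⁆-independent {x = x} G a b a∈⁅x⁆ b∈⁅x⁆ with x∈⁅y⁆⇒x≡y x a∈⁅x⁆ | x∈⁅y⁆⇒x≡y x b∈⁅x⁆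
... | refl | refl = irrefl G x

Consistent : Subset n → Subset n × Subset n → Set
Consistent S (F , F̄) = F ⊆ S × (∀ {x} → x ∈ F̄ → x ∉ S)

-- The perfect matching of a small crowned graph, and prop_avoid on it

module SmallCrowned {G : Graph n} {H C : Subset n} {M : List (Fin n × Fin n)}
  (H∪C≡⊤ : H ∪ C ≡ ⊤) (H∩C≡⊥ : H ∩ C ≡ ⊥)
  (M-edges : All (λ e → proj₁ e ∈ H × proj₂ e ∈ C × adj G (proj₁ e) (proj₂ e) ≡ true) M)
  (heads-unique : Unique (map proj₁ M)) (tails-unique : Unique (map proj₂ M))
  (∣M∣≡∣H∣ : length M ≡ ∣ H ∣) (∣H∣≡∣C∣ : ∣ H ∣ ≡ ∣ C ∣) where

  ∈H⊎∈C : ∀ x → x ∈ H ⊎ x ∈ C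
  ∈H⊎∈C x = x∈p∪q⁻ H C (subst (x ∈_) (sym H∪C≡⊤) ∈⊤)

  ∈H⇒∉C : x ∈ H → x ∉ C
  ∈H⇒∉C x∈H x∈C = ∉⊥ (subst (_ ∈_) H∩C≡⊥ (x∈p∩q⁺ (x∈H , x∈C)))

  heads⊆H : All (_∈ H) (map proj₁ M)
  heads⊆H = All.map⁺ (All.map proj₁ M-edges)

  tails⊆C : All (_∈ C) (map proj₂ M)
  tails⊆C = All.map⁺ (All.map (proj₁ ∘ proj₂) M-edges)

  head∈H : (x , y) ∈ₗ M → x ∈ H
  head∈H xy∈M = All.lookup heads⊆H (∈-map⁺ proj₁ xy∈M)

  tail∈C : (x , y) ∈ₗ M → y ∈ C
  tail∈C xy∈M = All.lookup tails⊆C (∈-map⁺ proj₂ xy∈M)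

  edge-adj : ∀ {e} → e ∈ₗ M → adj G (proj₁ e) (proj₂ e) ≡ true
  edge-adj e∈M = proj₂ (proj₂ (All.lookup M-edges e∈M))

  mates-adj : Mates M x y → adj G x y ≡ true
  mates-adj (inj₁ xy∈M) = edge-adj xy∈M
  mates-adj (inj₂ yx∈M) = trans (Graph.sym G _ _) (edge-adj yx∈M)

  H-matched : x ∈ H → ∃[ y ] (x , y) ∈ₗ M
  H-matched x∈H with ∈-map⁻ proj₁ (Unique∧length≡∣p∣⇒∈ heads-unique heads⊆H (trans (length-map proj₁ M) ∣M∣≡∣H∣) x∈H)
  ... | (_ , y) , xy∈M , refl = y , xy∈M

  C-matched : x ∈ C → ∃[ y ] (y , x) ∈ₗ M
  C-matched x∈C with ∈-map⁻ proj₂ (Unique∧length≡∣p∣⇒∈ tails-unique tails⊆C ∣tails∣≡∣C∣ x∈C)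
    where ∣tails∣≡∣C∣ = trans (length-map proj₂ M) (trans ∣M∣≡∣H∣ ∣H∣≡∣C∣)
  ... | (y , _) , yx∈M , refl = y , yx∈M

  mate : ∀ x → ∃[ y ] Mates M x y
  mate x = [ Product.map₂ inj₁ ∘ H-matched , Product.map₂ inj₂ ∘ C-matched ]′ (∈H⊎∈C x)

  ∣p∣≡sum-meets : ∀ p → ∣ p ∣ ≡ sum (map (meets p) M)
  ∣p∣≡sum-meets p = begin
    ∣ p ∣                                                           ≡⟨ Unique⇒∣p∣≡sum𝟙 endpoints-unique (λ {x} _ → endpoint x) ⟩
    sum (map (𝟙 p) (map proj₁ M ++ map proj₂ M))                    ≡⟨ cong sum (map-++ (𝟙 p) (map proj₁ M) _) ⟩
    sum (map (𝟙 p) (map proj₁ M) ++ map (𝟙 p) (map proj₂ M))        ≡⟨ sum-++ (map (𝟙 p) (map proj₁ M)) _ ⟩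
    sum (map (𝟙 p) (map proj₁ M)) + sum (map (𝟙 p) (map proj₂ M))   ≡⟨ sym (cong₂ _+_ (cong sum (map-∘ M)) (cong sum (map-∘ M))) ⟩
    sum (map (𝟙 p ∘ proj₁) M) + sum (map (𝟙 p ∘ proj₂) M)           ≡⟨ sym (sum-map-+ (𝟙 p ∘ proj₁) (𝟙 p ∘ proj₂) M) ⟩
    sum (map (meets p) M)                                           ∎
    where
    open ≡-Reasoning
    endpoints-unique : Unique (map proj₁ M ++ map proj₂ M)
    endpoints-unique = ++⁺ heads-unique tails-unique λ (x∈heads , x∈tails) →
      ∈H⇒∉C (All.lookup heads⊆H x∈heads) (All.lookup tails⊆C x∈tails)
    endpoint : ∀ x → x ∈ₗ map proj₁ M ++ map proj₂ M
    endpoint x with mate x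
    ... | _ , inj₁ xy∈M = ∈-++⁺ˡ (∈-map⁺ proj₁ xy∈M)
    ... | _ , inj₂ yx∈M = ∈-++⁺ʳ (map proj₁ M) (∈-map⁺ proj₂ yx∈M)

  cover-separates-mates : ∀ {S} → IsVertexCover G ⊤ S → ∣ S ∣ ≡ length M → Mates M x y → x ∈ S → y ∉ S
  cover-separates-mates {S = S} (_ , covers) ∣S∣≡∣M∣ mates x∈S y∈S =
    <-irrefl (sym ∣S∣≡∣M∣) (subst (length M <_) (sym (∣p∣≡sum-meets S)) (length<sum-map every-edge-met doubly-met))
    where
    every-edge-met : All (λ e → 1 ≤ meets S e) M
    every-edge-met = All.tabulate λ e∈M → 1≤meets (covers _ _ ∈⊤ ∈⊤ (edge-adj e∈M))
    doubly-met : Any (λ e → 2 ≤ meets S e) M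
    doubly-met = [ (λ xy∈M → lose xy∈M (2≤meets x∈S y∈S)) , (λ yx∈M → lose yx∈M (2≤meets y∈S x∈S)) ]′ mates

  module _ (v : Fin n) where

    avoidStep-consistent : ∀ {S F F̄} → Sol G ⊤ H S → (∀ {x} → x ∈ F̄ → x ∉ S) →
      avoidStep G M (F , F̄) ≡ just (nbhd G F̄ , MV M (nbhd G F̄)) × Consistent S (nbhd G F̄ , MV M (nbhd G F̄))
    avoidStep-consistent {S} {F} {F̄} (cover@(_ , covers) , ∣S∣≡∣H∣) F̄∩S=∅ =
      avoidStep-just⁺ G M {F} F̄ no-edge independent , N⊆S , MV∩S=∅
      where
      separates : Mates M x y → x ∈ S → y ∉ S
      separates = cover-separates-mates cover (trans ∣S∣≡∣H∣ (sym ∣M∣≡∣H∣))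
      N⊆S : nbhd G F̄ ⊆ S
      N⊆S u∈N = let _ , w , w∈F̄ , wu = ∈-nbhd⁻ G F̄ u∈N in [ absurd ∘ F̄∩S=∅ w∈F̄ , id ]′ (covers _ _ ∈⊤ ∈⊤ wu)
      MV∩S=∅ : ∀ {x} → x ∈ MV M (nbhd G F̄) → x ∉ S
      MV∩S=∅ x∈MV = let _ , y∈N , mates = ∈-MV⁻ M (nbhd G F̄) x∈MV in separates mates (N⊆S y∈N)
      no-edge : ¬ T (edgeInside M (nbhd G F̄))
      no-edge t = let _ , e∈M , a∈N , b∈N = edgeInside⁻ M (nbhd G F̄) t in separates (inj₁ e∈M) (N⊆S a∈N) (N⊆S b∈N)
      independent : Independent G (MV M (nbhd G F̄))
      independent a b a∈MV b∈MV = ¬-not λ ab → [ MV∩S=∅ a∈MV , MV∩S=∅ b∈MV ]′ (covers a b ∈⊤ ∈⊤ ab)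

    consistent-iterates : ∀ {S} → Sol G ⊤ H S → v ∉ S → ∀ i →
                          ∃[ state ] avoidIter G M v i ≡ just state × Consistent S state
    consistent-iterates {S} _ v∉S zero =
      (⊥ , ⁅ v ⁆) , refl , ⊥⊆ , λ x∈⁅v⁆ → subst (_∉ S) (sym (x∈⁅y⁆⇒x≡y v x∈⁅v⁆)) v∉S
    consistent-iterates sol v∉S (suc i) =
      let (F , _) , iterate , _ , F̄∩S=∅ = consistent-iterates sol v∉S i
          step , consistent             = avoidStep-consistent {F = F} sol F̄∩S=∅
      in _ , trans (avoidIter-suc i iterate) step , consistent

    fails⇒no-solution-avoiding : PropAvoidFails G M v → ¬ (Σ[ S ∈ Subset n ] Sol G ⊤ H S × v ∉ S)
    fails⇒no-solution-avoiding (i , fails , _) (S , sol , v∉S) =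
      let _ , iterate , _ = consistent-iterates sol v∉S (suc i) in contradiction (trans (sym iterate) fails) λ ()

    ⊆MV-nbhd : ∀ {F̄} → Independent G F̄ → F̄ ⊆ MV M (nbhd G F̄)
    ⊆MV-nbhd {F̄} independent {x} x∈F̄ =
      let y , mates = mate x
          y∉F̄ y∈F̄ = contradiction (trans (sym (mates-adj mates)) (independent x y x∈F̄ y∈F̄)) λ ()
      in ∈-MV⁺ M (nbhd G F̄) (∈-nbhd⁺ G F̄ x∈F̄ (mates-adj mates) y∉F̄) (swap mates)

    iterates-independent-∋v : ∀ i {F F̄} → avoidIter G M v i ≡ just (F , F̄) → Independent G F̄ × v ∈ F̄
    iterates-independent-∋v zero refl = ⁅x⁆-independent G , x∈⁅x⁆ v
    iterates-independent-∋v (suc i) iterate with avoidIter G M v i in previous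
    ... | just (F₀ , F̄₀) with avoidStep-just⁻ G M {F₀} F̄₀ iterate
    ...   | refl , independent =
      let F̄-independent , v∈F̄ = iterates-independent-∋v i previous in independent , ⊆MV-nbhd F̄-independent v∈F̄

    Stable : ℕ → Set
    Stable i = avoidIter G M v (suc i) ≡ avoidIter G M v i

    stable-or-growing : ∀ k → (∃[ i ] Stable i) ⊎ (∃₂ λ F F̄ → avoidIter G M v k ≡ just (F , F̄) × k ≤ ∣ F̄ ∣)
    stable-or-growing zero = inj₂ (⊥ , ⁅ v ⁆ , refl , z≤n)
    stable-or-growing (suc k) with stable-or-growing k
    ... | inj₁ stable = inj₁ stable
    ... | inj₂ (F , F̄ , iterate , k≤∣F̄∣) with avoidStep G M (F , F̄) in step
    ...   | nothing = inj₁ (suc k , trans (cong (_>>= avoidStep G M) failed) (sym failed))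
      where failed = trans (avoidIter-suc k iterate) step
    ...   | just (F′ , F̄′) with F̄ ⊂? F̄′
    ...     | yes F̄⊂F̄′ = inj₂ (F′ , F̄′ , trans (avoidIter-suc k iterate) step , ≤-<-trans k≤∣F̄∣ (p⊂q⇒∣p∣<∣q∣ F̄⊂F̄′))
    ...     | no  F̄⊄F̄′ = inj₁ (suc k , stable)
      where
      open ≡-Reasoning
      next = trans (avoidIter-suc k iterate) step
      F̄≡F̄′ : F̄ ≡ F̄′
      F̄≡F̄′ = ⊆∧⊄⇒≡ (subst (F̄ ⊆_) (sym (cong proj₂ (proj₁ (avoidStep-just⁻ G M {F} F̄ step))))
                      (⊆MV-nbhd (proj₁ (iterates-independent-∋v k iterate)))) F̄⊄F̄′
      -- avoidStep reads only F̄, so the states (F′ , F̄′) and (F , F̄) take the same step.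
      stable : Stable (suc k)
      stable = begin
        avoidIter G M v (suc (suc k)) ≡⟨ avoidIter-suc (suc k) next ⟩
        avoidStep G M (F′ , F̄′)       ≡⟨ cong (λ X → avoidStep G M (F′ , X)) (sym F̄≡F̄′) ⟩
        avoidStep G M (F , F̄)         ≡⟨ step ⟩
        just (F′ , F̄′)                ≡⟨ sym next ⟩
        avoidIter G M v (suc k)       ∎

    first-stable : ∃[ i ] Stable i × NotStoppedBefore G M v i
    first-stable with stable-or-growing (suc n)
    ... | inj₁ (i , stable) = least Stable? {i} stable
      where
      Stable? : Decidable Stable
      Stable? i = Maybe.≡-dec (Product.≡-dec (Vec.≡-dec Bool._≟_) (Vec.≡-dec Bool._≟_)) _ _
    ... | inj₂ (_ , F̄ , _ , n<∣F̄∣) = contradiction (∣p∣≤n F̄) (<⇒≱ n<∣F̄∣)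

    returns⇒fixed-point : ∀ {F F̄} → PropAvoidReturns G M v F F̄ →
                          F ≡ nbhd G F̄ × F̄ ≡ MV M F × Independent G F̄ × v ∈ F̄
    returns⇒fixed-point {F} {F̄} (i , next , current , _) =
      let fixed = proj₁ (avoidStep-just⁻ G M {F} F̄ (trans (sym (avoidIter-suc i current)) next))
          F≡N   = cong proj₁ fixed
      in F≡N , trans (cong proj₂ fixed) (cong (MV M) (sym F≡N)) , iterates-independent-∋v i current

    returns⇒consistent : ∀ {F F̄ S} → PropAvoidReturns G M v F F̄ → Sol G ⊤ H S → v ∉ S → Consistent S (F , F̄)
    returns⇒consistent (i , _ , current , _) sol v∉S =
      let _ , iterate , consistent = consistent-iterates sol v∉S i
      in subst (Consistent _) (just-injective (trans (sym iterate) current)) consistent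

    ¬fails⇒returns : ¬ PropAvoidFails G M v → ∃₂ λ F F̄ → PropAvoidReturns G M v F F̄ × F̄ ≡ MV M F
    ¬fails⇒returns no-failure with first-stable
    ... | i , stable , first with avoidIter G M v (suc i) in next
    ...   | nothing      = contradiction (i , next , first) no-failure
    ...   | just (F , F̄) = F , F̄ , returns , proj₁ (proj₂ (returns⇒fixed-point returns))
      where returns = i , next , sym stable , first

  module FixedPoint {F F̄ : Subset n} (F≡N : F ≡ nbhd G F̄) (F̄≡MV : F̄ ≡ MV M F)
                    (F̄-independent : Independent G F̄) where

    H′ C′ V′ : Subset n
    H′ = H ─ (F ∪ F̄)
    C′ = C ─ (F ∪ F̄)
    V′ = H′ ∪ C′

    F∩F̄=∅ : x ∈ F → x ∉ F̄
    F∩F̄=∅ x∈F = proj₁ (∈-nbhd⁻ G F̄ (subst (_ ∈_) F≡N x∈F))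

    F̄-neighbours∈F : x ∈ F̄ → adj G x y ≡ true → y ∈ F
    F̄-neighbours∈F {x} {y} x∈F̄ xy = subst (y ∈_) (sym F≡N) (∈-nbhd⁺ G F̄ x∈F̄ xy y∉F̄)
      where y∉F̄ = λ y∈F̄ → contradiction (trans (sym xy) (F̄-independent x y x∈F̄ y∈F̄)) λ ()

    mate∈F̄ : Mates M x y → x ∈ F → y ∈ F̄
    mate∈F̄ mates x∈F = subst (_ ∈_) (sym F̄≡MV) (∈-MV⁺ M F x∈F mates)

    mate∈F : Mates M x y → x ∈ F̄ → y ∈ F
    mate∈F mates x∈F̄ = F̄-neighbours∈F x∈F̄ (mates-adj mates)

    mate∈F∪F̄ : Mates M x y → x ∈ F ∪ F̄ → y ∈ F ∪ F̄
    mate∈F∪F̄ mates = [ x∈p∪q⁺ ∘ inj₂ ∘ mate∈F̄ mates , x∈p∪q⁺ ∘ inj₁ ∘ mate∈F mates ]′ ∘ x∈p∪q⁻ F F̄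

    mate∉F∪F̄ : Mates M x y → x ∉ F ∪ F̄ → y ∉ F ∪ F̄
    mate∉F∪F̄ mates x∉F∪F̄ = x∉F∪F̄ ∘ mate∈F∪F̄ (swap mates)

    ∉F∪F̄⇒∈V′ : x ∉ F ∪ F̄ → x ∈ V′
    ∉F∪F̄⇒∈V′ {x} x∉F∪F̄ = x∈p∪q⁺ (Sum.map (flip x∈p∧x∉q⇒x∈p─q x∉F∪F̄) (flip x∈p∧x∉q⇒x∈p─q x∉F∪F̄) (∈H⊎∈C x))

    ∈V′⇒∉F∪F̄ : x ∈ V′ → x ∉ F ∪ F̄
    ∈V′⇒∉F∪F̄ x∈V′ = [ x∈p─q⇒x∉q , x∈p─q⇒x∉q ]′ (x∈p∪q⁻ H′ C′ x∈V′)

    ∈F⇒∉V′ : x ∈ F → x ∉ V′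
    ∈F⇒∉V′ x∈F x∈V′ = ∈V′⇒∉F∪F̄ x∈V′ (x∈p∪q⁺ (inj₁ x∈F))

    𝟙H′-tail : (x , y) ∈ₗ M → 𝟙 H′ y ≡ 0
    𝟙H′-tail xy∈M = 𝟙-∉ (x∉p⇒x∉p─q λ y∈H → ∈H⇒∉C y∈H (tail∈C xy∈M))

    𝟙C′-head : (x , y) ∈ₗ M → 𝟙 C′ x ≡ 0
    𝟙C′-head xy∈M = 𝟙-∉ (x∉p⇒x∉p─q (∈H⇒∉C (head∈H xy∈M)))

    meets-F+meets-H′≡1 : (x , y) ∈ₗ M → meets F (x , y) + meets H′ (x , y) ≡ 1
    meets-F+meets-H′≡1 {x} xy∈M with x ∈? F ∪ F̄
    ... | yes x∈F∪F̄ = [ (λ x∈F → cong₂ _+_ (cong₂ _+_ (𝟙-∈ x∈F) (𝟙-∉ (flip F∩F̄=∅ (mate∈F̄ (inj₁ xy∈M) x∈F)))) x∉H′)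
                      , (λ x∈F̄ → cong₂ _+_ (cong₂ _+_ (𝟙-∉ (flip F∩F̄=∅ x∈F̄)) (𝟙-∈ (mate∈F (inj₁ xy∈M) x∈F̄))) x∉H′)
                      ]′ (x∈p∪q⁻ F F̄ x∈F∪F̄)
      where x∉H′ = cong₂ _+_ (𝟙-∉ (x∈q⇒x∉p─q x∈F∪F̄)) (𝟙H′-tail xy∈M)
    ... | no x∉F∪F̄ = cong₂ _+_ (cong₂ _+_ (𝟙-∉ (x∉F∪F̄ ∘ x∈p∪q⁺ ∘ inj₁)) (𝟙-∉ (mate∉F∪F̄ (inj₁ xy∈M) x∉F∪F̄ ∘ x∈p∪q⁺ ∘ inj₁)))
                               (cong₂ _+_ (𝟙-∈ (x∈p∧x∉q⇒x∈p─q (head∈H xy∈M) x∉F∪F̄)) (𝟙H′-tail xy∈M))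

    meets-C′≡meets-H′ : (x , y) ∈ₗ M → meets C′ (x , y) ≡ meets H′ (x , y)
    meets-C′≡meets-H′ {x} {y} xy∈M with x ∈? F ∪ F̄
    ... | yes x∈F∪F̄ = begin
      𝟙 C′ x + 𝟙 C′ y ≡⟨ cong₂ _+_ (𝟙C′-head xy∈M) (𝟙-∉ (x∈q⇒x∉p─q (mate∈F∪F̄ (inj₁ xy∈M) x∈F∪F̄))) ⟩
      0               ≡⟨ sym (cong₂ _+_ (𝟙-∉ (x∈q⇒x∉p─q x∈F∪F̄)) (𝟙H′-tail xy∈M)) ⟩
      𝟙 H′ x + 𝟙 H′ y ∎
      where open ≡-Reasoning
    ... | no x∉F∪F̄ = begin
      𝟙 C′ x + 𝟙 C′ y ≡⟨ cong₂ _+_ (𝟙C′-head xy∈M) (𝟙-∈ (x∈p∧x∉q⇒x∈p─q (tail∈C xy∈M) (mate∉F∪F̄ (inj₁ xy∈M) x∉F∪F̄))) ⟩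
      1               ≡⟨ sym (cong₂ _+_ (𝟙-∈ (x∈p∧x∉q⇒x∈p─q (head∈H xy∈M) x∉F∪F̄)) (𝟙H′-tail xy∈M)) ⟩
      𝟙 H′ x + 𝟙 H′ y ∎
      where open ≡-Reasoning

    ∣F∣+∣H′∣≡∣H∣ : ∣ F ∣ + ∣ H′ ∣ ≡ ∣ H ∣
    ∣F∣+∣H′∣≡∣H∣ = begin
      ∣ F ∣ + ∣ H′ ∣                                 ≡⟨ cong₂ _+_ (∣p∣≡sum-meets F) (∣p∣≡sum-meets H′) ⟩
      sum (map (meets F) M) + sum (map (meets H′) M) ≡⟨ sym (sum-map-+ (meets F) (meets H′) M) ⟩
      sum (map (λ e → meets F e + meets H′ e) M)     ≡⟨ sum-map-1 (All.tabulate meets-F+meets-H′≡1) ⟩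
      length M                                       ≡⟨ ∣M∣≡∣H∣ ⟩
      ∣ H ∣                                          ∎
      where open ≡-Reasoning

    ∣C′∣≡∣H′∣ : ∣ C′ ∣ ≡ ∣ H′ ∣
    ∣C′∣≡∣H′∣ = begin
      ∣ C′ ∣                 ≡⟨ ∣p∣≡sum-meets C′ ⟩
      sum (map (meets C′) M) ≡⟨ cong sum (map-cong-local (All.tabulate meets-C′≡meets-H′)) ⟩
      sum (map (meets H′) M) ≡⟨ sym (∣p∣≡sum-meets H′) ⟩
      ∣ H′ ∣                 ∎
      where open ≡-Reasoning

    M′ : List (Fin n × Fin n)
    M′ = filter (λ e → proj₁ e ∈? H′) M

    ∣M′∣≡∣H′∣ : length M′ ≡ ∣ H′ ∣
    ∣M′∣≡∣H′∣ = begin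
      length M′                  ≡⟨ length-filter (λ e → proj₁ e ∈? H′) M ⟩
      sum (map (𝟙 H′ ∘ proj₁) M) ≡⟨ cong sum (map-cong-local (All.tabulate λ {e} e∈M →
                                      sym (trans (cong (𝟙 H′ (proj₁ e) +_) (𝟙H′-tail e∈M)) (+-identityʳ _)))) ⟩
      sum (map (meets H′) M)     ≡⟨ sym (∣p∣≡sum-meets H′) ⟩
      ∣ H′ ∣                     ∎
      where open ≡-Reasoning

    remainder-crowned : Independent G C → IsCrownedWith G V′ H′ C′ M′
    remainder-crowned C-independent =
      refl , H′∩C′≡⊥ , C′-independent , (M′-edges , heads′-unique , tails′-unique) , ∣M′∣≡∣H′∣
      where
      H′∩C′≡⊥ : H′ ∩ C′ ≡ ⊥
      H′∩C′≡⊥ = Empty-unique λ (_ , x∈H′∩C′) →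
        let x∈H′ , x∈C′ = x∈p∩q⁻ H′ C′ x∈H′∩C′ in ∈H⇒∉C (p─q⊆p H _ x∈H′) (p─q⊆p C _ x∈C′)
      C′-independent : Independent G C′
      C′-independent a b a∈C′ b∈C′ = C-independent a b (p─q⊆p C _ a∈C′) (p─q⊆p C _ b∈C′)
      M′-edges : All (λ e → proj₁ e ∈ H′ × proj₂ e ∈ C′ × adj G (proj₁ e) (proj₂ e) ≡ true) M′
      M′-edges = All.tabulate λ e∈M′ →
        let e∈M , head∈H′ = ∈-filter⁻ (λ e → proj₁ e ∈? H′) e∈M′
        in head∈H′ , x∈p∧x∉q⇒x∈p─q (tail∈C e∈M) (mate∉F∪F̄ (inj₁ e∈M) (x∈p─q⇒x∉q head∈H′)) , edge-adj e∈M
      heads′-unique : Unique (map proj₁ M′)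
      heads′-unique = AllPairs.map⁺ (AllPairs.filter⁺ _ (AllPairs.map⁻ heads-unique))
      tails′-unique : Unique (map proj₂ M′)
      tails′-unique = AllPairs.map⁺ (AllPairs.filter⁺ _ (AllPairs.map⁻ tails-unique))

    restrict-solution : ∀ {S} → Sol G ⊤ H S → Consistent S (F , F̄) →
                        F ⊆ S × S ∩ F̄ ≡ ⊥ × Sol G V′ H′ (S ∩ (C′ ∪ H′))
    restrict-solution {S} ((_ , covers) , ∣S∣≡∣H∣) (F⊆S , F̄∩S=∅) = F⊆S , S∩F̄≡⊥ , (S′⊆V′ , covers′) , ∣S′∣≡∣H′∣
      where
      S′ = S ∩ (C′ ∪ H′)
      S∩F̄≡⊥ : S ∩ F̄ ≡ ⊥
      S∩F̄≡⊥ = Empty-unique λ (_ , x∈S∩F̄) → let x∈S , x∈F̄ = x∈p∩q⁻ S F̄ x∈S∩F̄ in F̄∩S=∅ x∈F̄ x∈S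
      ∈S′ : x ∈ S → x ∈ V′ → x ∈ S′
      ∈S′ x∈S x∈V′ = x∈p∩q⁺ (x∈S , subst (_ ∈_) (∪-comm H′ C′) x∈V′)
      S′⊆V′ : S′ ⊆ V′
      S′⊆V′ x∈S′ = subst (_ ∈_) (∪-comm C′ H′) (proj₂ (x∈p∩q⁻ S _ x∈S′))
      covers′ : ∀ a b → a ∈ V′ → b ∈ V′ → adj G a b ≡ true → a ∈ S′ ⊎ b ∈ S′
      covers′ a b a∈V′ b∈V′ ab = Sum.map (flip ∈S′ a∈V′) (flip ∈S′ b∈V′) (covers a b ∈⊤ ∈⊤ ab)
      S⊆F∪S′ : S ⊆ F ∪ S′
      S⊆F∪S′ {x} x∈S with x ∈? F
      ... | yes x∈F = x∈p∪q⁺ (inj₁ x∈F)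
      ... | no  x∉F = x∈p∪q⁺ (inj₂ (∈S′ x∈S (∉F∪F̄⇒∈V′ (x∉p∧x∉q⇒x∉p∪q x∉F (flip F̄∩S=∅ x∈S)))))
      F∪S′⊆S : F ∪ S′ ⊆ S
      F∪S′⊆S = [ F⊆S , proj₁ ∘ x∈p∩q⁻ S _ ]′ ∘ x∈p∪q⁻ F S′
      ∣S′∣≡∣H′∣ : ∣ S′ ∣ ≡ ∣ H′ ∣
      ∣S′∣≡∣H′∣ = +-cancelˡ-≡ ∣ F ∣ _ _ $ begin
        ∣ F ∣ + ∣ S′ ∣ ≡⟨ sym (∣p∪q∣≡∣p∣+∣q∣ F S′ λ x∈F → ∈F⇒∉V′ x∈F ∘ S′⊆V′) ⟩
        ∣ F ∪ S′ ∣     ≡⟨ cong ∣_∣ (⊆-antisym F∪S′⊆S S⊆F∪S′) ⟩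
        ∣ S ∣          ≡⟨ ∣S∣≡∣H∣ ⟩
        ∣ H ∣          ≡⟨ sym ∣F∣+∣H′∣≡∣H∣ ⟩
        ∣ F ∣ + ∣ H′ ∣ ∎
        where open ≡-Reasoning

    extend-solution : ∀ {S′ z} → z ∈ F̄ → Sol G V′ H′ S′ → Sol G ⊤ H (F ∪ S′) × z ∉ F ∪ S′
    extend-solution {S′} z∈F̄ ((S′⊆V′ , covers′) , ∣S′∣≡∣H′∣) = (((λ _ → ∈⊤) , covers) , ∣F∪S′∣≡∣H∣) , z∉F∪S′
      where
      F∪F̄-edge : x ∈ F ∪ F̄ → adj G x y ≡ true → x ∈ F ⊎ y ∈ F
      F∪F̄-edge x∈F∪F̄ xy = Sum.map₂ (flip F̄-neighbours∈F xy) (x∈p∪q⁻ F F̄ x∈F∪F̄)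
      covers : ∀ a b → a ∈ ⊤ → b ∈ ⊤ → adj G a b ≡ true → a ∈ F ∪ S′ ⊎ b ∈ F ∪ S′
      covers a b _ _ ab with a ∈? F ∪ F̄ | b ∈? F ∪ F̄
      ... | yes a∈F∪F̄ | _         = Sum.map (x∈p∪q⁺ ∘ inj₁) (x∈p∪q⁺ ∘ inj₁) (F∪F̄-edge a∈F∪F̄ ab)
      ... | no _       | yes b∈F∪F̄ =
        swap (Sum.map (x∈p∪q⁺ ∘ inj₁) (x∈p∪q⁺ ∘ inj₁) (F∪F̄-edge b∈F∪F̄ (trans (Graph.sym G b a) ab)))
      ... | no a∉F∪F̄  | no b∉F∪F̄  =
        Sum.map (x∈p∪q⁺ ∘ inj₂) (x∈p∪q⁺ ∘ inj₂) (covers′ a b (∉F∪F̄⇒∈V′ a∉F∪F̄) (∉F∪F̄⇒∈V′ b∉F∪F̄) ab)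
      ∣F∪S′∣≡∣H∣ : ∣ F ∪ S′ ∣ ≡ ∣ H ∣
      ∣F∪S′∣≡∣H∣ = begin
        ∣ F ∪ S′ ∣     ≡⟨ ∣p∪q∣≡∣p∣+∣q∣ F S′ (λ x∈F → ∈F⇒∉V′ x∈F ∘ S′⊆V′) ⟩
        ∣ F ∣ + ∣ S′ ∣ ≡⟨ cong (∣ F ∣ +_) ∣S′∣≡∣H′∣ ⟩
        ∣ F ∣ + ∣ H′ ∣ ≡⟨ ∣F∣+∣H′∣≡∣H∣ ⟩
        ∣ H ∣          ∎
        where open ≡-Reasoning
      z∉F∪S′ = [ flip F∩F̄=∅ z∈F̄ , (λ z∈S′ → ∈V′⇒∉F∪F̄ (S′⊆V′ z∈S′) (x∈p∪q⁺ (inj₂ z∈F̄))) ]′ ∘ x∈p∪q⁻ F S′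

lemma14 : ∀ {n} (G : Graph n) (H C : Subset n) (M : List (Fin n × Fin n))
    → IsCrownedWith G ⊤ H C M → ∣ H ∣ ≡ ∣ C ∣
    → (v : Fin n) → v ∈ H
    → (PropAvoidFails G M v → ¬ (Σ[ S ∈ Subset n ] Sol G ⊤ H S × v ∉ S))
    × (¬ PropAvoidFails G M v
        → Σ[ F ∈ Subset n ] Σ[ F̄ ∈ Subset n ] PropAvoidReturns G M v F F̄ × F̄ ≡ MV M F)
    × (∀ F F̄ → PropAvoidReturns G M v F F̄
        → (∀ S → Sol G ⊤ H S → v ∉ S
             → F ⊆ S × S ∩ F̄ ≡ ⊥
               × Sol G ((H ─ (F ∪ F̄)) ∪ (C ─ (F ∪ F̄))) (H ─ (F ∪ F̄))
                     (S ∩ ((C ─ (F ∪ F̄)) ∪ (H ─ (F ∪ F̄)))))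
        × IsCrowned G ((H ─ (F ∪ F̄)) ∪ (C ─ (F ∪ F̄))) (H ─ (F ∪ F̄)) (C ─ (F ∪ F̄))
        × ∣ C ─ (F ∪ F̄) ∣ ≡ ∣ H ─ (F ∪ F̄) ∣
        × (∀ S' → Sol G ((H ─ (F ∪ F̄)) ∪ (C ─ (F ∪ F̄))) (H ─ (F ∪ F̄)) S'
             → Sol G ⊤ H (F ∪ S') × v ∉ F ∪ S'))
lemma14 G H C M (H∪C≡⊤ , H∩C≡⊥ , C-independent , (M-edges , heads-unique , tails-unique) , ∣M∣≡∣H∣) ∣H∣≡∣C∣ v _ =
    fails⇒no-solution-avoiding v
  , ¬fails⇒returns v
  , λ F F̄ returns →
      let F≡N , F̄≡MV , F̄-independent , v∈F̄ = returns⇒fixed-point v returns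
          open FixedPoint F≡N F̄≡MV F̄-independent
      in (λ S sol v∉S → restrict-solution sol (returns⇒consistent v returns sol v∉S))
       , (M′ , remainder-crowned C-independent)
       , ∣C′∣≡∣H′∣
       , λ _ → extend-solution v∈F̄
  where open SmallCrowned H∪C≡⊤ H∩C≡⊥ M-edges heads-unique tails-unique ∣M∣≡∣H∣ ∣H∣≡∣C∣
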